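{- Let $\mathbf G$ be a strongly connected digraph that contains a cycle walk of every length greater than one, and let $A$ be a finite set of vertices of $\mathbf G$. Then there is a finite subdigraph $\mathbf G'\subseteq\mathbf G$ that is strongly connected, contains a cycle walk of every length greater than one, and contains all elements of $A$.
   Context: A walk of length $m$ is $[v_0,\ldots,v_m]$ with $v_i\to v_{i+1}$; a cycle walk has $v_0=v_m$. Strongly connected: a walk exists between any ordered pair of vertices. $\mathbf G$ may be infinite. -}

module Defs where

open import Data.Nat using (ℕ; zero; suc; _≤_)
open import Data.Product using (Σ; ∃; _×_)
open import Data.List using (List)
open import Data.List.Membership.Propositional using (_∈_)

record Digraph : Set₁ where
  field
    Vertex : Set
    _⟶_    : Vertex → Vertex → Set

data Walk {V : Set} (E : V → V → Set) : V → V → ℕ → Set where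
  [_]  : (v : V) → Walk E v v zero
  _∷_  : {u w v : V} {m : ℕ} → E u w → Walk E w v m → Walk E u v (suc m)

StronglyConnectedOn : {V : Set} → (V → Set) → (V → V → Set) → Set
StronglyConnectedOn P E = ∀ u v → P u → P v → ∃ λ m → Walk E u v m

AllCycleLengthsOn : {V : Set} → (V → Set) → (V → V → Set) → Set
AllCycleLengthsOn P E = ∀ m → 2 ≤ m → ∃ λ v → P v × Walk E v v m


StronglyConnected : Digraph → Set
StronglyConnected G = StronglyConnectedOn {Vertex} (λ _ → ⊤) _⟶_
  where open Digraph G
        open import Data.Unit using (⊤)

AllCycleLengths : Digraph → Set
AllCycleLengths G = AllCycleLengthsOn {Vertex} (λ _ → ⊤) _⟶_
  where open Digraph G
        open import Data.Unit using (⊤)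

record SubDigraph (G : Digraph) : Set₁ where
  open Digraph G
  field
    InV    : Vertex → Set
    InE    : Vertex → Vertex → Set
    edge⊆  : ∀ {u v} → InE u v → u ⟶ v
    src∈   : ∀ {u v} → InE u v → InV u
    tgt∈   : ∀ {u v} → InE u v → InV v

-- Finite: all its vertices occur in some finite list (hence finitely many edges
-- as well, up to the edge relation of G).
IsFinite : {G : Digraph} → SubDigraph G → Set
IsFinite {G} G' = Σ (List (Digraph.Vertex G)) λ vs → ∀ v → SubDigraph.InV G' v → v ∈ vs

SubStronglyConnected : {G : Digraph} → SubDigraph G → Set
SubStronglyConnected G' = StronglyConnectedOn (SubDigraph.InV G') (SubDigraph.InE G')

SubAllCycleLengths : {G : Digraph} → SubDigraph G → Set
SubAllCycleLengths G' = AllCycleLengthsOn (SubDigraph.InV G') (SubDigraph.InE G')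

-- Fix a closed walk C₂ of length 2 at a vertex u and one C₃ of length 3 at a
-- vertex w, and walks P : u → w and Q : w → u.  The closed walks C₂ PQ and
-- P C₃ Q at u have consecutive lengths n and n + 1, so appending copies of C₂
-- yields closed walks at u of every length ≥ n.  The finite subdigraph induced
-- by finitely many closed walks through u — those two, a cycle of each length
-- 2, …, n + 1 joined to u, and a walk u → a → u for each a ∈ A — is strongly
-- connected, since every vertex lies on a closed walk through u.
module Submission where

open import Defs
open import Data.Product using (Σ; _×_)
open import Data.List using (List)
open import Data.List.Relation.Unary.All using (All)

open import Data.Nat using (ℕ; suc; _+_; _∸_; _≤_; _<_; z≤n; s≤s)
open import Data.Nat.Properties using (+-assoc; +-comm; m∸n+n≡m; ≮⇒≥; m≤n⇒m≤o+n; _<?_)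
open import Data.Product using (∃; _,_; proj₁; proj₂)
open import Data.Unit using (tt)
open import Data.List using ([]; _∷_; _++_; map; concatMap; applyUpTo)
open import Data.List.Membership.Propositional using (_∈_; lose; find)
open import Data.List.Membership.Propositional.Properties
  using (∈-map⁺; ∈-++⁺ˡ; ∈-++⁺ʳ; ∈-concatMap⁺; ∈-concatMap⁻; ∈-applyUpTo⁺)
open import Data.List.Relation.Unary.Any using (here; there)
import Data.List.Relation.Unary.All as All
open import Function using (_∘_)
open import Relation.Binary.PropositionalEquality using (_≡_; refl; sym; trans; cong; subst)
open import Relation.Nullary using (yes; no)

module _ {V : Set} {R : V → V → Set} where

  vertices : ∀ {a b m} → Walk R a b m → List V
  vertices [ v ]         = v ∷ []
  vertices (_∷_ {u} _ w) = u ∷ vertices w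

  infixr 5 _++ʷ_
  _++ʷ_ : ∀ {a b c m n} → Walk R a b m → Walk R b c n → Walk R a c (m + n)
  [ _ ]   ++ʷ q = q
  (e ∷ p) ++ʷ q = e ∷ (p ++ʷ q)

  source∈vertices : ∀ {a b m} (w : Walk R a b m) → a ∈ vertices w
  source∈vertices [ _ ]   = here refl
  source∈vertices (_ ∷ _) = here refl

  ∈-vertices-++ʷˡ : ∀ {a b c m n x} (p : Walk R a b m) (q : Walk R b c n) →
                    x ∈ vertices p → x ∈ vertices (p ++ʷ q)
  ∈-vertices-++ʷˡ [ _ ]   q (here refl) = source∈vertices q
  ∈-vertices-++ʷˡ (_ ∷ p) q (here refl) = here refl
  ∈-vertices-++ʷˡ (_ ∷ p) q (there x∈p) = there (∈-vertices-++ʷˡ p q x∈p)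

  ∈-vertices-++ʷʳ : ∀ {a b c m n x} (p : Walk R a b m) (q : Walk R b c n) →
                    x ∈ vertices q → x ∈ vertices (p ++ʷ q)
  ∈-vertices-++ʷʳ [ _ ]   q x∈q = x∈q
  ∈-vertices-++ʷʳ (_ ∷ p) q x∈q = there (∈-vertices-++ʷʳ p q x∈q)

  splitAtVertex : ∀ {a b m x} (w : Walk R a b m) → x ∈ vertices w →
                  ∃ (Walk R a x) × ∃ (Walk R x b)
  splitAtVertex [ v ]   (here refl) = (0 , [ v ]) , (0 , [ v ])
  splitAtVertex w@(_∷_ {u} _ _) (here refl) = (0 , [ u ]) , (_ , w)
  splitAtVertex (e ∷ w) (there x∈w) with splitAtVertex w x∈w
  ... | (_ , p) , q = (_ , e ∷ p) , q

  hub⇒stronglyConnected : ∀ {P : V → Set} (u : V) →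
    (∀ x → P x → ∃ (Walk R u x) × ∃ (Walk R x u)) → StronglyConnectedOn P R
  hub⇒stronglyConnected u through x y Px Py
    with through x Px | through y Py
  ... | _ , (_ , x⇝u) | (_ , u⇝y) , _ = _ , x⇝u ++ʷ u⇝y

  module _ {u : V} (c₂ : Walk R u u 2) where

    closedWalk-+ : ∀ {n} → Walk R u u n → Walk R u u (suc n) →
                   ∀ k → Walk R u u (k + n)
    closedWalk-+ w w′ 0             = w
    closedWalk-+ w w′ 1             = w′
    closedWalk-+ w w′ (suc (suc k)) = c₂ ++ʷ closedWalk-+ w w′ k

    closedWalk-≥ : ∀ {n} → Walk R u u n → Walk R u u (suc n) →
                   ∀ {m} → n ≤ m → Walk R u u m
    closedWalk-≥ {n} w w′ {m} n≤m =
      subst (Walk R u u) (m∸n+n≡m n≤m) (closedWalk-+ w w′ (m ∸ n))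

Induced : {V : Set} → (V → V → Set) → (V → Set) → V → V → Set
Induced E P x y = E x y × P x × P y

induced : (G : Digraph) → (Digraph.Vertex G → Set) → SubDigraph G
induced G P = record
  { InV   = P
  ; InE   = Induced (Digraph._⟶_ G) P
  ; edge⊆ = proj₁
  ; src∈  = proj₁ ∘ proj₂
  ; tgt∈  = proj₂ ∘ proj₂
  }

module _ {V : Set} {E : V → V → Set} {P : V → Set} where

  restrict : ∀ {a b m} (w : Walk E a b m) → (∀ {x} → x ∈ vertices w → P x) →
             Walk (Induced E P) a b m
  restrict [ v ]   _  = [ v ]
  restrict (e ∷ w) in-P =
    (e , in-P (here refl) , in-P (there (source∈vertices w))) ∷ restrict w (in-P ∘ there)

  vertices-restrict : ∀ {a b m} (w : Walk E a b m) (in-P : ∀ {x} → x ∈ vertices w → P x) →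
                      vertices (restrict w in-P) ≡ vertices w
  vertices-restrict [ _ ]         _    = refl
  vertices-restrict (_∷_ {u} _ w) in-P = cong (u ∷_) (vertices-restrict w (in-P ∘ there))

module _ {V : Set} {E : V → V → Set} {u : V} (loops : List (∃ (Walk E u u))) where

  Spanned : V → Set
  Spanned x = x ∈ concatMap (vertices ∘ proj₂) loops

  ∈-loop⇒spanned : ∀ {m} {ℓ : Walk E u u m} → (m , ℓ) ∈ loops →
                   ∀ {x} → x ∈ vertices ℓ → Spanned x
  ∈-loop⇒spanned ℓ∈ x∈ℓ = ∈-concatMap⁺ (vertices ∘ proj₂) (lose ℓ∈ x∈ℓ)

  spanned-stronglyConnected : StronglyConnectedOn Spanned (Induced E Spanned)
  spanned-stronglyConnected = hub⇒stronglyConnected u through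
    where
    through : ∀ x → Spanned x →
              ∃ (Walk (Induced E Spanned) u x) × ∃ (Walk (Induced E Spanned) x u)
    through x x∈ with find (∈-concatMap⁻ (vertices ∘ proj₂) {xs = loops} x∈)
    ... | (_ , ℓ) , ℓ∈ , x∈ℓ =
      splitAtVertex (restrict ℓ in-S)
        (subst (x ∈_) (sym (vertices-restrict ℓ in-S)) x∈ℓ)
      where in-S = ∈-loop⇒spanned ℓ∈

module Construction (G : Digraph) (sc : StronglyConnected G) (cyc : AllCycleLengths G)
                    (A : List (Digraph.Vertex G)) where
  open Digraph G

  reach : (a b : Vertex) → ∃ (Walk _⟶_ a b)
  reach a b = sc a b tt tt

  cycleBase : ℕ → Vertex
  cycleBase j = proj₁ (cyc (2 + j) (s≤s (s≤s z≤n)))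

  cycleAt : (j : ℕ) → Walk _⟶_ (cycleBase j) (cycleBase j) (2 + j)
  cycleAt j = proj₂ (proj₂ (cyc (2 + j) (s≤s (s≤s z≤n))))

  u w : Vertex
  u = cycleBase 0
  w = cycleBase 1

  Loop : Set
  Loop = ∃ (Walk _⟶_ u u)

  u⇝ : (a : Vertex) → Walk _⟶_ u a (proj₁ (reach u a))
  u⇝ a = proj₂ (reach u a)

  ⇝u : (a : Vertex) → Walk _⟶_ a u (proj₁ (reach a u))
  ⇝u a = proj₂ (reach a u)

  threshold : ℕ
  threshold = 2 + (proj₁ (reach u w) + proj₁ (reach w u))

  visit : Vertex → Loop
  visit a = _ , u⇝ a ++ʷ ⇝u a

  aroundCycle : ℕ → Loop
  aroundCycle j = _ , u⇝ (cycleBase j) ++ʷ cycleAt j ++ʷ ⇝u (cycleBase j)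

  loops : List Loop
  loops = (_ , cycleAt 0 ++ʷ u⇝ w ++ʷ ⇝u w)
        ∷ (_ , u⇝ w ++ʷ cycleAt 1 ++ʷ ⇝u w)
        ∷ applyUpTo aroundCycle threshold ++ map visit A

  core : SubDigraph G
  core = induced G (Spanned loops)

  core-finite : IsFinite core
  core-finite = _ , λ _ x∈ → x∈

  core-stronglyConnected : SubStronglyConnected core
  core-stronglyConnected = spanned-stronglyConnected loops

  core-contains : All (SubDigraph.InV core) A
  core-contains = All.tabulate λ {a} a∈A →
    ∈-loop⇒spanned loops (there (there (∈-++⁺ʳ _ (∈-map⁺ visit a∈A))))
      (∈-vertices-++ʷʳ (u⇝ a) (⇝u a) (source∈vertices (⇝u a)))

  CoreWalk : Vertex → Vertex → ℕ → Set
  CoreWalk = Walk (SubDigraph.InE core)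

  restrictLoop : ∀ {m} {ℓ : Walk _⟶_ u u m} → (m , ℓ) ∈ loops → CoreWalk u u m
  restrictLoop {ℓ = ℓ} ℓ∈ = restrict ℓ (∈-loop⇒spanned loops ℓ∈)

  core-cycle-< : ∀ j → j < threshold → ∃ λ v → Spanned loops v × CoreWalk v v (2 + j)
  core-cycle-< j j<n = cycleBase j , in-core (source∈vertices (cycleAt j)) , restrict (cycleAt j) in-core
    where
    in-core : ∀ {x} → x ∈ vertices (cycleAt j) → Spanned loops x
    in-core = ∈-loop⇒spanned loops (there (there (∈-++⁺ˡ (∈-applyUpTo⁺ aroundCycle j<n))))
            ∘ ∈-vertices-++ʷʳ (u⇝ _) _ ∘ ∈-vertices-++ʷˡ (cycleAt j) (⇝u _)

  core-closedWalk-≥ : ∀ {m} → threshold ≤ m → CoreWalk u u m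
  core-closedWalk-≥ = closedWalk-≥ c₂ (restrictLoop (here refl)) lengthN+1
    where
    c₂ : CoreWalk u u 2
    c₂ = restrict (cycleAt 0) (∈-loop⇒spanned loops (here refl) ∘ ∈-vertices-++ʷˡ (cycleAt 0) _)

    p+[3+q]≡3+[p+q] : ∀ p q → p + (3 + q) ≡ 3 + (p + q)
    p+[3+q]≡3+[p+q] p q = trans (sym (+-assoc p 3 q)) (cong (_+ q) (+-comm p 3))

    lengthN+1 : CoreWalk u u (suc threshold)
    lengthN+1 = subst (CoreWalk u u) (p+[3+q]≡3+[p+q] (proj₁ (reach u w)) (proj₁ (reach w u)))
                      (restrictLoop (there (here refl)))

  core-allCycleLengths : SubAllCycleLengths core
  core-allCycleLengths 1 (s≤s ())
  core-allCycleLengths (suc (suc j)) _ with j <? threshold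
  ... | yes j<n = core-cycle-< j j<n
  ... | no j≮n  = u , ∈-loop⇒spanned loops (here refl) (source∈vertices _) ,
                  core-closedWalk-≥ (m≤n⇒m≤o+n 2 (≮⇒≥ j≮n))

lemma3p3 : (G : Digraph) → StronglyConnected G → AllCycleLengths G →
    (A : List (Digraph.Vertex G)) →
    Σ (SubDigraph G) λ G' → IsFinite G' × SubStronglyConnected G' × SubAllCycleLengths G' × All (SubDigraph.InV G') A
lemma3p3 G sc cyc A =
  core , core-finite , core-stronglyConnected , core-allCycleLengths , core-contains
  where open Construction G sc cyc A
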